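{- The maximum, over all $8$-element subsets $S\subseteq \mathbb{F}_3^4$, of the number of sets contained in $S$ is $8$.
   Context: Cards of the game SET (with $4$ properties, each taking $3$ values) are identified with points of $\mathbb{F}_3^4$. A set is a $3$-element subset $\{p,q,r\}$ of distinct points of $\mathbb{F}_3^4$ with $p+q+r=0$ (equivalently, an affine line in $\mathbb{F}_3^4$). The number of sets contained in $S$ is the number of $3$-element subsets of $S$ that are sets. -}

module Defs where

open import Data.Nat using (ℕ; zero; suc; _+_)
open import Data.Fin using (Fin)
open import Data.Fin.Properties using (_≟_)
open import Data.Vec using (Vec; zipWith)
open import Data.Vec.Properties using (≡-dec)
open import Data.List using (List; []; _∷_; length; map; _++_; filter)
open import Relation.Nullary using (Dec)
open import Data.Product using (_×_; _,_; proj₁; proj₂)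
open import Relation.Binary.PropositionalEquality using (_≡_)

F3 : Set
F3 = Fin 3

_+₃_ : F3 → F3 → F3
Fin.zero +₃ y = y
Fin.suc Fin.zero +₃ Fin.zero = Fin.suc Fin.zero
Fin.suc Fin.zero +₃ Fin.suc Fin.zero = Fin.suc (Fin.suc Fin.zero)
Fin.suc Fin.zero +₃ Fin.suc (Fin.suc Fin.zero) = Fin.zero
Fin.suc (Fin.suc Fin.zero) +₃ Fin.zero = Fin.suc (Fin.suc Fin.zero)
Fin.suc (Fin.suc Fin.zero) +₃ Fin.suc Fin.zero = Fin.zero
Fin.suc (Fin.suc Fin.zero) +₃ Fin.suc (Fin.suc Fin.zero) = Fin.suc Fin.zero

Card : Set
Card = Vec F3 4

_⊕_ : Card → Card → Card
_⊕_ = zipWith _+₃_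

zeroCard : Card
zeroCard = Fin.zero Data.Vec.∷ Fin.zero Data.Vec.∷ Fin.zero Data.Vec.∷ Fin.zero Data.Vec.∷ Data.Vec.[]

_≟C_ : (p q : Card) → Dec (p ≡ q)
_≟C_ = ≡-dec _≟_

-- A set: three cards p q r (distinct, which is ensured by choosing them
-- from distinct positions of a duplicate-free list) with p + q + r = 0.
IsSet : Card → Card → Card → Set
IsSet p q r = (p ⊕ q) ⊕ r ≡ zeroCard

isSet? : (p q r : Card) → Dec (IsSet p q r)
isSet? p q r = ((p ⊕ q) ⊕ r) ≟C zeroCard

triples : List Card → List (Card × Card × Card)
triples [] = []
triples (p ∷ xs) = map (λ qr → p , proj₁ qr , proj₂ qr) (pairs xs) ++ triples xs
  where
  pairs : List Card → List (Card × Card)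
  pairs [] = []
  pairs (q ∷ ys) = map (λ r → q , r) ys ++ pairs ys

numSets : List Card → ℕ
numSets S = length (filter (λ t → isSet? (proj₁ t) (proj₁ (proj₂ t)) (proj₂ (proj₂ t))) (triples S))

-- A point p of S lies on at most ⌊(|S| − 1)/2⌋ sets inside S: the sets through p
-- pair up the other points q via q ↦ −(p + q), and within S that map is a partial
-- involution without fixed points. Summing over the points of S counts every set
-- three times, so 3 · #sets ≤ 8 · 3 for |S| = 8. The bound is attained by the eight
-- non-zero points of a plane: of the twelve lines of AG(2,3), only the four
-- through the origin are lost. Only three laws of the completion p · q = −(p + q)
-- enter the count: it is commutative, idempotent and satisfies p · (p · q) = q.
module Submission where

open import Defs
open import Data.Nat using (ℕ; suc; _+_; _*_; _≤_; _<_; z≤n; s≤s)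
open import Data.Nat.Properties
  using ( +-assoc; +-mono-≤; *-identityʳ; ≤-trans; ≤-reflexive; <-≤-trans; m≤n+m; m<m+n
        ; m<1+n⇒m≤n; *-cancelˡ-<; *-cancelˡ-≤; +-commutativeSemigroup; module ≤-Reasoning)
open import Data.Nat.Tactic.RingSolver using (solve-∀)
open import Algebra.Properties.CommutativeSemigroup +-commutativeSemigroup using (interchange)
open import Data.Fin using (Fin)
open import Data.Fin.Properties using (all?) renaming (_≟_ to _≟₃_)
open import Data.Vec using (Vec; _∷_; []; zipWith; replicate)
open import Data.Vec.Properties using (zipWith-comm; zipWith-idem; ∷-injective)
open import Data.List using (List; []; _∷_; length; map; _++_; filter)
open import Data.List.Relation.Unary.All using (All; _∷_; []; tabulate)
open import Data.List.Relation.Unary.AllPairs using (_∷_; []; allPairs?)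
open import Data.List.Relation.Unary.Unique.Propositional using (Unique)
open import Data.List.Relation.Unary.Any using (here; there)
open import Data.List.Membership.Propositional using (_∈_)
open import Data.Product using (_×_; Σ; _,_; proj₁; proj₂)
open import Function using (_∘_; _⇔_; mk⇔; Equivalence)
open import Relation.Binary.Definitions using (DecidableEquality)
open import Relation.Nullary using (Dec; yes; no; ¬?; contradiction)
open import Relation.Nullary.Decidable using (from-yes; _→-dec_)
open import Relation.Binary.PropositionalEquality
  using (_≡_; _≢_; refl; sym; trans; cong; cong₂; module ≡-Reasoning)

indicator : ∀ {ℓ} {P : Set ℓ} → Dec P → ℕ
indicator (yes _) = 1
indicator (no _)  = 0

indicator-cong : ∀ {ℓ ℓ′} {P : Set ℓ} {Q : Set ℓ′} → P ⇔ Q → (P? : Dec P) (Q? : Dec Q) →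
                 indicator P? ≡ indicator Q?
indicator-cong P⇔Q (yes _) (yes _) = refl
indicator-cong P⇔Q (yes p) (no ¬q) = contradiction (Equivalence.to P⇔Q p) ¬q
indicator-cong P⇔Q (no ¬p) (yes q) = contradiction (Equivalence.from P⇔Q q) ¬p
indicator-cong P⇔Q (no _)  (no _)  = refl

∑ : ∀ {a} {A : Set a} → List A → (A → ℕ) → ℕ
∑ []       f = 0
∑ (x ∷ xs) f = f x + ∑ xs f

syntax ∑ xs (λ x → e) = ∑[ x ∈ xs ] e

module _ {a} {A : Set a} where

  ∑-cong : ∀ {f g : A → ℕ} → (∀ x → f x ≡ g x) → ∀ xs → ∑ xs f ≡ ∑ xs g
  ∑-cong f≗g []       = refl
  ∑-cong f≗g (x ∷ xs) = cong₂ _+_ (f≗g x) (∑-cong f≗g xs)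

  ∑-+ : ∀ (f g : A → ℕ) xs → ∑[ x ∈ xs ] (f x + g x) ≡ ∑ xs f + ∑ xs g
  ∑-+ f g []       = refl
  ∑-+ f g (x ∷ xs) = trans (cong (f x + g x +_) (∑-+ f g xs)) (interchange (f x) (g x) _ _)

  ∑-++ : ∀ (f : A → ℕ) xs ys → ∑ (xs ++ ys) f ≡ ∑ xs f + ∑ ys f
  ∑-++ f []       ys = refl
  ∑-++ f (x ∷ xs) ys = trans (cong (f x +_) (∑-++ f xs ys)) (sym (+-assoc (f x) _ _))

  ∑-map : ∀ {b} {B : Set b} (f : B → ℕ) (g : A → B) xs → ∑ (map g xs) f ≡ ∑[ x ∈ xs ] f (g x)
  ∑-map f g []       = refl
  ∑-map f g (x ∷ xs) = cong (f (g x) +_) (∑-map f g xs)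

  ∑-≤ : ∀ {f : A → ℕ} {k xs} → All (λ x → f x ≤ k) xs → ∑ xs f ≤ length xs * k
  ∑-≤ []           = z≤n
  ∑-≤ (fx≤k ∷ f≤k) = +-mono-≤ fx≤k (∑-≤ f≤k)

  length-filter≡∑ : ∀ {p} {P : A → Set p} (P? : ∀ x → Dec (P x)) xs →
                    length (filter P? xs) ≡ ∑[ x ∈ xs ] indicator (P? x)
  length-filter≡∑ P? []       = refl
  length-filter≡∑ P? (x ∷ xs) with P? x
  ... | yes _ = cong suc (length-filter≡∑ P? xs)
  ... | no  _ = length-filter≡∑ P? xs

sublists₂ : ∀ {a} {A : Set a} → List A → List (A × A)
sublists₂ []       = []
sublists₂ (q ∷ ys) = map (q ,_) ys ++ sublists₂ ys

sublists₃ : ∀ {a} {A : Set a} → List A → List (A × A × A)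
sublists₃ []       = []
sublists₃ (p ∷ xs) = map (p ,_) (sublists₂ xs) ++ sublists₃ xs

module Multiplicity {a} {A : Set a} (_≟_ : DecidableEquality A) where

  count : A → List A → ℕ
  count x ys = ∑[ y ∈ ys ] indicator (x ≟ y)

  count-∉ : ∀ {x ys} → All (x ≢_) ys → count x ys ≡ 0
  count-∉ {x} []                = refl
  count-∉ {x} {y ∷ _} (x≢y ∷ x∉) with x ≟ y
  ... | yes x≡y = contradiction x≡y x≢y
  ... | no  _   = count-∉ x∉

  count-unique : ∀ {x ys} → Unique ys → count x ys ≤ 1
  count-unique {x} []                    = z≤n
  count-unique {x} {y ∷ ys} (y∉ ∷ unique) with x ≟ y
  ... | yes refl = ≤-reflexive (cong suc (count-∉ y∉))
  ... | no  _    = count-unique unique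

  count-∈ : ∀ {x ys} → x ∈ ys → 0 < count x ys
  count-∈ {x} {y ∷ ys} (here x≡y) with x ≟ y
  ... | yes _   = s≤s z≤n
  ... | no  x≢y = contradiction x≡y x≢y
  count-∈ {x} {y ∷ ys} (there x∈) = ≤-trans (count-∈ x∈) (m≤n+m _ (indicator (x ≟ y)))

module Lines {a} {A : Set a} (_≟_ : DecidableEquality A) (_·_ : A → A → A) where

  open Multiplicity _≟_

  IsLine : A × A × A → Set a
  IsLine (p , q , r) = p · q ≡ r

  isLine? : ∀ t → Dec (IsLine t)
  isLine? (p , q , r) = (p · q) ≟ r

  linesThrough : A → List A → ℕ
  linesThrough p []       = 0
  linesThrough p (q ∷ ys) = count (p · q) ys + linesThrough p ys

  numLines : List A → ℕ
  numLines []       = 0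
  numLines (p ∷ xs) = linesThrough p xs + numLines xs

  linesThrough-sublists₂ : ∀ p ys →
    ∑[ qr ∈ sublists₂ ys ] indicator (isLine? (p , qr)) ≡ linesThrough p ys
  linesThrough-sublists₂ p []       = refl
  linesThrough-sublists₂ p (q ∷ ys) =
    trans (∑-++ _ (map (q ,_) ys) (sublists₂ ys))
          (cong₂ _+_ (∑-map _ (q ,_) ys) (linesThrough-sublists₂ p ys))

  numLines-sublists₃ : ∀ xs → ∑[ t ∈ sublists₃ xs ] indicator (isLine? t) ≡ numLines xs
  numLines-sublists₃ []       = refl
  numLines-sublists₃ (p ∷ xs) =
    trans (∑-++ _ (map (p ,_) (sublists₂ xs)) (sublists₃ xs))
          (cong₂ _+_ (trans (∑-map _ (p ,_) (sublists₂ xs)) (linesThrough-sublists₂ p xs))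
                     (numLines-sublists₃ xs))

  module Steiner (·-comm : ∀ p q → p · q ≡ q · p) (·-idem : ∀ p → p · p ≡ p)
                 (·-involutive : ∀ p q → p · (p · q) ≡ q) where

    ·-cancelˡ : ∀ p {q r} → p · q ≡ p · r → q ≡ r
    ·-cancelˡ p {q} {r} pq≡pr = begin
      q           ≡⟨ sym (·-involutive p q) ⟩
      p · (p · q) ≡⟨ cong (p ·_) pq≡pr ⟩
      p · (p · r) ≡⟨ ·-involutive p r ⟩
      r           ∎
      where open ≡-Reasoning

    ·-swap : ∀ p q r → p · q ≡ r ⇔ p · r ≡ q
    ·-swap p q r = mk⇔ (λ { refl → ·-involutive p q }) (λ { refl → ·-involutive p r })

    ·-fixed⇔≡ : ∀ p q → p · q ≡ q ⇔ p ≡ q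
    ·-fixed⇔≡ p q = mk⇔ (λ pq≡q → ·-cancelˡ q (trans (·-comm q p) (trans pq≡q (sym (·-idem q)))))
                        (λ { refl → ·-idem p })

    completions : A → List A → List A → ℕ
    completions p xs zs = ∑[ q ∈ xs ] count (p · q) zs

    completions-∷ : ∀ p xs z zs → completions p xs (z ∷ zs) ≡ count (p · z) xs + completions p xs zs
    completions-∷ p xs z zs =
      trans (∑-+ _ _ xs)
            (cong (_+ completions p xs zs) (∑-cong (λ q → indicator-cong (·-swap p q z) _ _) xs))

    -- A pair (q , z) with q ≠ z is counted together with (z , q); a diagonal
    -- pair (q , q) is counted exactly when q = p.
    completions-self : ∀ p xs → completions p xs xs ≡ 2 * linesThrough p xs + count p xs
    completions-self p []       = refl
    completions-self p (q ∷ ys) = begin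
      (indicator ((p · q) ≟ q) + C) + completions p ys (q ∷ ys)
        ≡⟨ cong₂ (λ d c → (d + C) + c) (indicator-cong (·-fixed⇔≡ p q) ((p · q) ≟ q) (p ≟ q))
                 (completions-∷ p ys q ys) ⟩
      (d + C) + (C + completions p ys ys)
        ≡⟨ cong (λ c → (d + C) + (C + c)) (completions-self p ys) ⟩
      (d + C) + (C + (2 * L + n))
        ≡⟨ rearrange d C L n ⟩
      2 * (C + L) + (d + n) ∎
      where
      open ≡-Reasoning
      C = count (p · q) ys
      L = linesThrough p ys
      n = count p ys
      d = indicator (p ≟ q)
      rearrange : ∀ d C L n → (d + C) + (C + (2 * L + n)) ≡ 2 * (C + L) + (d + n)
      rearrange = solve-∀

    completions-≤ : ∀ p xs {zs} → Unique zs → completions p xs zs ≤ length xs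
    completions-≤ p xs {zs} unique =
      ≤-trans (∑-≤ {f = λ q → count (p · q) zs} (tabulate {xs = xs} (λ _ → count-unique unique)))
              (≤-reflexive (*-identityʳ (length xs)))

    linesThrough-bound : ∀ {p S} → Unique S → p ∈ S → 2 * linesThrough p S < length S
    linesThrough-bound {p} {S} unique p∈S = begin-strict
      2 * linesThrough p S              <⟨ m<m+n _ (count-∈ p∈S) ⟩
      2 * linesThrough p S + count p S  ≡⟨ completions-self p S ⟨
      completions p S S                 ≤⟨ completions-≤ p S unique ⟩
      length S                          ∎
      where open ≤-Reasoning

    ∑-linesThrough-∷ : ∀ xs z zs →
      ∑[ p ∈ xs ] linesThrough p (z ∷ zs) ≡ completions z xs zs + ∑[ p ∈ xs ] linesThrough p zs
    ∑-linesThrough-∷ xs z zs =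
      trans (∑-+ _ _ xs) (cong (_+ _) (∑-cong (λ p → cong (λ w → count w zs) (·-comm p z)) xs))

    ∑-linesThrough : ∀ {S} → Unique S → ∑[ p ∈ S ] linesThrough p S ≡ 3 * numLines S
    ∑-linesThrough {[]}     []             = refl
    ∑-linesThrough {x ∷ xs} (x∉ ∷ unique) = begin
      (count (x · x) xs + L) + ∑[ p ∈ xs ] linesThrough p (x ∷ xs)
        ≡⟨ cong₂ (λ y s → (count y xs + L) + s) (·-idem x) (∑-linesThrough-∷ xs x xs) ⟩
      (n + L) + (completions x xs xs + ∑[ p ∈ xs ] linesThrough p xs)
        ≡⟨ cong₂ (λ c s → (n + L) + (c + s)) (completions-self x xs) (∑-linesThrough unique) ⟩
      (n + L) + ((2 * L + n) + 3 * numLines xs)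
        ≡⟨ cong (λ m → (m + L) + ((2 * L + m) + 3 * numLines xs)) (count-∉ x∉) ⟩
      (0 + L) + ((2 * L + 0) + 3 * numLines xs)
        ≡⟨ rearrange L (numLines xs) ⟩
      3 * (L + numLines xs) ∎
      where
      open ≡-Reasoning
      L = linesThrough x xs
      n = count x xs
      rearrange : ∀ L M → (0 + L) + ((2 * L + 0) + 3 * M) ≡ 3 * (L + M)
      rearrange = solve-∀

    numLines-bound : ∀ {S} k → Unique S → length S ≤ 2 * suc k → 3 * numLines S ≤ length S * k
    numLines-bound {S} k unique |S|≤2[k+1] = begin
      3 * numLines S                 ≡⟨ ∑-linesThrough unique ⟨
      ∑[ p ∈ S ] linesThrough p S    ≤⟨ ∑-≤ (tabulate linesThrough-≤) ⟩
      length S * k                   ∎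
      where
      open ≤-Reasoning
      linesThrough-≤ : ∀ {p} → p ∈ S → linesThrough p S ≤ k
      linesThrough-≤ p∈S =
        m<1+n⇒m≤n (*-cancelˡ-< 2 _ _ (<-≤-trans (linesThrough-bound unique p∈S) |S|≤2[k+1]))

pattern 0₃ = Fin.zero
pattern 1₃ = Fin.suc Fin.zero
pattern 2₃ = Fin.suc (Fin.suc Fin.zero)

third₃ : F3 → F3 → F3
third₃ a b = (a +₃ b) +₃ (a +₃ b)

third₃-comm : ∀ a b → third₃ a b ≡ third₃ b a
third₃-comm = from-yes (all? λ a → all? λ b → third₃ a b ≟₃ third₃ b a)

third₃-idem : ∀ a → third₃ a a ≡ a
third₃-idem = from-yes (all? λ a → third₃ a a ≟₃ a)

third₃-involutive : ∀ a b → third₃ a (third₃ a b) ≡ b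
third₃-involutive = from-yes (all? λ a → all? λ b → third₃ a (third₃ a b) ≟₃ b)

+₃-double-inverse : ∀ s → s +₃ (s +₃ s) ≡ 0₃
+₃-double-inverse = from-yes (all? λ s → (s +₃ (s +₃ s)) ≟₃ 0₃)

+₃-inverse-unique : ∀ s c → s +₃ c ≡ 0₃ → s +₃ s ≡ c
+₃-inverse-unique = from-yes (all? λ s → all? λ c → ((s +₃ c) ≟₃ 0₃) →-dec ((s +₃ s) ≟₃ c))

third : ∀ {n} → Vec F3 n → Vec F3 n → Vec F3 n
third = zipWith third₃

third-comm : ∀ {n} (p q : Vec F3 n) → third p q ≡ third q p
third-comm = zipWith-comm third₃-comm

third-idem : ∀ {n} (p : Vec F3 n) → third p p ≡ p
third-idem = zipWith-idem third₃-idem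

third-involutive : ∀ {n} (p q : Vec F3 n) → third p (third p q) ≡ q
third-involutive []      []      = refl
third-involutive (a ∷ p) (b ∷ q) = cong₂ _∷_ (third₃-involutive a b) (third-involutive p q)

third-completes : ∀ {n} (p q : Vec F3 n) →
  zipWith _+₃_ (zipWith _+₃_ p q) (third p q) ≡ replicate n 0₃
third-completes []      []      = refl
third-completes (a ∷ p) (b ∷ q) = cong₂ _∷_ (+₃-double-inverse (a +₃ b)) (third-completes p q)

third-unique : ∀ {n} (p q r : Vec F3 n) →
  zipWith _+₃_ (zipWith _+₃_ p q) r ≡ replicate n 0₃ → third p q ≡ r
third-unique []      []      []      _  = refl
third-unique (a ∷ p) (b ∷ q) (c ∷ r) eq =
  cong₂ _∷_ (+₃-inverse-unique (a +₃ b) c (proj₁ (∷-injective eq)))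
            (third-unique p q r (proj₂ (∷-injective eq)))

isSet⇔third : ∀ p q r → IsSet p q r ⇔ third p q ≡ r
isSet⇔third p q r = mk⇔ (third-unique p q r) (λ { refl → third-completes p q })

open Lines _≟C_ third
open Steiner third-comm third-idem third-involutive

isSetᵗ? : (t : Card × Card × Card) → Dec (IsSet (proj₁ t) (proj₁ (proj₂ t)) (proj₂ (proj₂ t)))
isSetᵗ? t = isSet? (proj₁ t) (proj₁ (proj₂ t)) (proj₂ (proj₂ t))

-- Defs enumerates pairs through a local helper that cannot be named, so its
-- enumeration agrees with sublists₃ only by evaluation at a fixed length.
triples≡sublists₃ : ∀ S → length S ≡ 8 → triples S ≡ sublists₃ S
triples≡sublists₃ (_ ∷ _ ∷ _ ∷ _ ∷ _ ∷ _ ∷ _ ∷ _ ∷ []) _ = refl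
triples≡sublists₃ []                                    ()
triples≡sublists₃ (_ ∷ [])                              ()
triples≡sublists₃ (_ ∷ _ ∷ [])                          ()
triples≡sublists₃ (_ ∷ _ ∷ _ ∷ [])                      ()
triples≡sublists₃ (_ ∷ _ ∷ _ ∷ _ ∷ [])                  ()
triples≡sublists₃ (_ ∷ _ ∷ _ ∷ _ ∷ _ ∷ [])              ()
triples≡sublists₃ (_ ∷ _ ∷ _ ∷ _ ∷ _ ∷ _ ∷ [])          ()
triples≡sublists₃ (_ ∷ _ ∷ _ ∷ _ ∷ _ ∷ _ ∷ _ ∷ [])      ()
triples≡sublists₃ (_ ∷ _ ∷ _ ∷ _ ∷ _ ∷ _ ∷ _ ∷ _ ∷ _ ∷ _) ()

numSets≡numLines : ∀ S → length S ≡ 8 → numSets S ≡ numLines S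
numSets≡numLines S |S|≡8 = begin
  length (filter isSetᵗ? (triples S))
    ≡⟨ cong (length ∘ filter isSetᵗ?) (triples≡sublists₃ S |S|≡8) ⟩
  length (filter isSetᵗ? (sublists₃ S))        ≡⟨ length-filter≡∑ isSetᵗ? (sublists₃ S) ⟩
  ∑[ t ∈ sublists₃ S ] indicator (isSetᵗ? t)   ≡⟨ ∑-cong same-indicator (sublists₃ S) ⟩
  ∑[ t ∈ sublists₃ S ] indicator (isLine? t)   ≡⟨ numLines-sublists₃ S ⟩
  numLines S                                   ∎
  where
  open ≡-Reasoning
  same-indicator : ∀ t → indicator (isSetᵗ? t) ≡ indicator (isLine? t)
  same-indicator (p , q , r) = indicator-cong (isSet⇔third p q r) (isSet? p q r) (third p q ≟C r)

plane : List Card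
plane = point 0₃ 1₃ ∷ point 0₃ 2₃ ∷ point 1₃ 0₃ ∷ point 1₃ 1₃
      ∷ point 1₃ 2₃ ∷ point 2₃ 0₃ ∷ point 2₃ 1₃ ∷ point 2₃ 2₃ ∷ []
  where
  point : F3 → F3 → Card
  point a b = a ∷ b ∷ 0₃ ∷ 0₃ ∷ []

plane-unique : Unique plane
plane-unique = from-yes (allPairs? (λ x y → ¬? (x ≟C y)) plane)

numSets≤8 : (S : List Card) → length S ≡ 8 → Unique S → numSets S ≤ 8
numSets≤8 S |S|≡8 unique = *-cancelˡ-≤ 3 (begin
  3 * numSets S   ≡⟨ cong (3 *_) (numSets≡numLines S |S|≡8) ⟩
  3 * numLines S  ≤⟨ numLines-bound 3 unique (≤-reflexive |S|≡8) ⟩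
  length S * 3    ≡⟨ cong (_* 3) |S|≡8 ⟩
  24              ∎)
  where open ≤-Reasoning

mainTheorem7 : ((S : List Card) → length S ≡ 8 → Unique S → numSets S ≤ 8)
    × Σ (List Card) (λ S → length S ≡ 8 × Unique S × numSets S ≡ 8)
mainTheorem7 = numSets≤8 , plane , refl , plane-unique , refl
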